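{- Let $X=\{1,\dots,r\}$, $K$ a $k$-element set disjoint from $X$, and $m,m':X\times X\to K\cup\{0\}$ maps whose images contain $K$. Then $N(X,K,m)\cong N(X,K,m')$ if and only if $\mathbf P_m$ and $\mathbf P_{m'}$ lie in the same orbit of the action of $\mathbb S_r$ on $\mathcal{PP}_k(X\times X)$.
   Context: $0\notin X\cup K$. $N(X,K,m)$ is the semigroup on $X\cup K\cup\{0\}$ with $xy=m(x,y)$ for $x,y\in X$ and all other products equal to $0$ (a $3$-nilpotent semigroup). $\mathbf P_m$ is the partial partition $\{m^{ -1}(c):c\in K\}$ of $X\times X$ into $k$ non-empty parts. $\mathcal{PP}_k(X\times X)$ is the set of partial partitions of $X\times X$ into $k$ parts (families of $k$ pairwise disjoint non-empty subsets). $\mathbb S_r$ acts on $X\times X$ by $(x,y)\pi=(x\pi,y\pi)$ and on partial partitions by $\{P_1,\dots,P_k\}\pi=\{P_1\pi,\dots,P_k\pi\}$. -}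

module Defs where

open import Level using (0ℓ)
open import Data.Nat using (ℕ)
open import Data.Fin using (Fin)
open import Data.Maybe using (Maybe; just; nothing)
open import Data.Product using (_×_; _,_; ∃; ∃₂; Σ)
open import Function.Bundles using (_⇔_)
open import Relation.Binary.PropositionalEquality using (_≡_; refl; trans; sym; isEquivalence; cong₂)
open import Algebra.Bundles using (Semigroup)
open import Algebra.Structures using (IsMagma; IsSemigroup)
open import Algebra.Morphism.Structures using (module MagmaMorphisms)
open import Data.Fin.Permutation using (Permutation′; _⟨$⟩ˡ_)

-- X = Fin r, K = Fin k; the carrier X ∪ K ∪ {0} as a disjoint union.
data Elt (r k : ℕ) : Set where
  var : Fin r → Elt r k
  con : Fin k → Elt r k
  zer : Elt r k

-- A map m : X × X → K ∪ {0}, with `nothing` standing for 0.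
Table : ℕ → ℕ → Set
Table r k = Fin r → Fin r → Maybe (Fin k)

Surjective-onto-K : ∀ {r k} → Table r k → Set
Surjective-onto-K {r} {k} m = (c : Fin k) → ∃₂ λ (x y : Fin r) → m x y ≡ just c

inj : ∀ {r k} → Maybe (Fin k) → Elt r k
inj (just c) = con c
inj nothing  = zer

mul : ∀ {r k} → Table r k → Elt r k → Elt r k → Elt r k
mul m (var x) (var y) = inj (m x y)
mul m (var x) (con _) = zer
mul m (var x) zer     = zer
mul m (con _) _       = zer
mul m zer     _       = zer

private
  mul-inj : ∀ {r k} (m : Table r k) (v : Maybe (Fin k)) (z : Elt r k) → mul m (inj v) z ≡ zer
  mul-inj m (just c) z = refl
  mul-inj m nothing  z = refl

  inj-mul : ∀ {r k} (m : Table r k) (x : Fin r) (v : Maybe (Fin k)) → mul m (var x) (inj v) ≡ zer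
  inj-mul m x (just c) = refl
  inj-mul m x nothing  = refl

  assoc : ∀ {r k} (m : Table r k) (a b c : Elt r k) → mul m (mul m a b) c ≡ mul m a (mul m b c)
  assoc m (var x) (var y) (var z) = trans (mul-inj m (m x y) (var z)) (sym (inj-mul m x (m y z)))
  assoc m (var x) (var y) (con z) = mul-inj m (m x y) (con z)
  assoc m (var x) (var y) zer     = mul-inj m (m x y) zer
  assoc m (var x) (con _) c       = refl
  assoc m (var x) zer c           = refl
  assoc m (con _) b c             = refl
  assoc m zer b c                 = refl

N : ∀ {r k} → Table r k → Semigroup 0ℓ 0ℓ
N {r} {k} m = record
  { Carrier = Elt r k
  ; _≈_ = _≡_
  ; _∙_ = mul m
  ; isSemigroup = record
    { isMagma = record { isEquivalence = isEquivalence ; ∙-cong = cong₂ (mul m) }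
    ; assoc = assoc m
    }
  }

_≅_ : Semigroup 0ℓ 0ℓ → Semigroup 0ℓ 0ℓ → Set
S ≅ T = Σ (Semigroup.Carrier S → Semigroup.Carrier T)
          (MagmaMorphisms.IsMagmaIsomorphism (Semigroup.rawMagma S) (Semigroup.rawMagma T))

Subset² : ℕ → Set₁
Subset² r = Fin r × Fin r → Set

_≐_ : ∀ {r} → Subset² r → Subset² r → Set
A ≐ B = ∀ p → A p ⇔ B p

preimage : ∀ {r k} → Table r k → Fin k → Subset² r
preimage m c (x , y) = m x y ≡ just c

-- P_m = { m⁻¹(c) : c ∈ K }, as a K-indexed family of subsets
P : ∀ {r k} → Table r k → Fin k → Subset² r
P m = preimage m

-- right action of π on subsets: Pπ = {(xπ, yπ) : (x,y) ∈ P},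
-- i.e. (u,v) ∈ Pπ iff (uπ⁻¹, vπ⁻¹) ∈ P
act : ∀ {r} → Subset² r → Permutation′ r → Subset² r
act A π (u , v) = A (π ⟨$⟩ˡ u , π ⟨$⟩ˡ v)

-- Equality of the families {A c : c ∈ K} and {B c : c ∈ K} as sets of subsets
SameFamily : ∀ {r k} → (Fin k → Subset² r) → (Fin k → Subset² r) → Set
SameFamily {r} {k} A B =
  ((c : Fin k) → ∃ λ (d : Fin k) → A c ≐ B d) ×
  ((d : Fin k) → ∃ λ (c : Fin k) → A c ≐ B d)

actFamily : ∀ {r k} → (Fin k → Subset² r) → Permutation′ r → Fin k → Subset² r
actFamily A π c = act (A c) π

SameOrbit : ∀ {r k} → (Fin k → Subset² r) → (Fin k → Subset² r) → Set
SameOrbit {r} A B = ∃ λ (π : Permutation′ r) → SameFamily (actFamily A π) B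

-- Since m hits every c ∈ K, the products of N(X,K,m) are exactly K ∪ {0}, and 0 is its
-- only idempotent; so an isomorphism N(X,K,m) ≅ N(X,K,m′) maps X onto X, K onto K and 0
-- to 0, i.e. it is a relabelling (π, σ) ∈ 𝕊_r × 𝕊_k with m′(xπ, yπ) = σ(m(x, y)).
-- Such a relabelling says exactly that π carries each class m⁻¹(c) onto m′⁻¹(σc).
-- Conversely, as the classes of P_m are non-empty and pairwise disjoint, an equality of
-- families P_m π = P_m′ determines the bijection σ of K that matches them up.
module Submission where

open import Defs
open import Data.Nat using (ℕ)
open import Data.Fin using (Fin)
open import Data.Fin.Permutation using (Permutation′; _⟨$⟩ʳ_; _⟨$⟩ˡ_; inverseˡ; inverseʳ; flip)
open import Data.Maybe using (Maybe; just; nothing)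
import Data.Maybe as Maybe
open import Data.Maybe.Properties using (just-injective; map-injective)
open import Data.Product using (_,_; proj₁; proj₂; ∃; ∃₂; Σ)
open import Data.Sum using (_⊎_; inj₁; inj₂)
open import Data.Empty using (⊥-elim)
open import Function.Bundles using (_⇔_; mk⇔; Equivalence; _↔_; Inverse; mk↔ₛ′; mk⤖; Bijection; Injection)
open import Function.Definitions using (Injective)
open import Function.Properties.Bijection using (⤖⇒↔)
open import Function.Properties.Inverse using (↔⇒⤖; ↔⇒↣)
open import Function.Construct.Symmetry using (↔-sym; ⇔-sym)
open import Function.Construct.Composition using (_⇔-∘_)
open import Function.Construct.Identity using (⇔-id)
open import Relation.Binary.PropositionalEquality
open import Algebra.Morphism.Structures using (module MagmaMorphisms)

private
  variable
    r k : ℕ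
    m m′ : Table r k

var-injective : Injective _≡_ _≡_ (var {r} {k})
var-injective refl = refl

con-injective : Injective _≡_ _≡_ (con {r} {k})
con-injective refl = refl

inj-injective : Injective _≡_ _≡_ (inj {r} {k})
inj-injective {x = just _}  {just _}  refl = refl
inj-injective {x = nothing} {nothing} refl = refl
inj-injective {x = just _}  {nothing} ()
inj-injective {x = nothing} {just _}  ()

mul-con⊎zer : (m : Table r k) (a b : Elt r k) → (∃ λ d → mul m a b ≡ con d) ⊎ mul m a b ≡ zer
mul-con⊎zer m (var x) (var y) with m x y
... | just d  = inj₁ (d , refl)
... | nothing = inj₂ refl
mul-con⊎zer m (var _) (con _) = inj₂ refl
mul-con⊎zer m (var _) zer     = inj₂ refl
mul-con⊎zer m (con _) _       = inj₂ refl
mul-con⊎zer m zer     _       = inj₂ refl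

mul≢var : (m : Table r k) (a b : Elt r k) {x : Fin r} → mul m a b ≢ var x
mul≢var m a b p with mul-con⊎zer m a b
... | inj₁ (d , q) with () ← trans (sym q) p
... | inj₂ q       with () ← trans (sym q) p

var⊎mul : Surjective-onto-K m → (e : Elt r k) → (∃ λ u → e ≡ var u) ⊎ (∃₂ λ a b → e ≡ mul m a b)
var⊎mul sm (var u) = inj₁ (u , refl)
var⊎mul sm (con c) with sm c
... | x , y , e = inj₂ (var x , var y , sym (cong inj e))
var⊎mul sm zer     = inj₂ (zer , zer , refl)

idempotent⇒zer : (m : Table r k) {e : Elt r k} → mul m e e ≡ e → e ≡ zer
idempotent⇒zer m {var x} p = ⊥-elim (mul≢var m (var x) (var x) p)
idempotent⇒zer m {zer}   p = refl

Homomorphic : Table r k → Table r k → (Elt r k → Elt r k) → Set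
Homomorphic m m′ h = ∀ a b → h (mul m a b) ≡ mul m′ (h a) (h b)

≅⇒↔ : N m ≅ N m′ → ∃ λ (I : Elt r k ↔ Elt r k) → Homomorphic m m′ (Inverse.to I)
≅⇒↔ (f , iso) = ⤖⇒↔ (mk⤖ (injective , surjective)) , homo
  where open MagmaMorphisms.IsMagmaIsomorphism iso

↔⇒≅ : (I : Elt r k ↔ Elt r k) → Homomorphic m m′ (Inverse.to I) → N m ≅ N m′
↔⇒≅ I homo = to , record
  { isMagmaMonomorphism = record
    { isMagmaHomomorphism = record { isRelHomomorphism = record { cong = to-cong } ; homo = homo }
    ; injective = injective
    }
  ; surjective = surjective
  }
  where open Bijection (↔⇒⤖ I) using (to; injective; surjective) renaming (cong to to-cong)

homomorphic-from : (I : Elt r k ↔ Elt r k) →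
                   Homomorphic m m′ (Inverse.to I) → Homomorphic m′ m (Inverse.from I)
homomorphic-from {m = m} {m′ = m′} I homo a b = begin
  from (mul m′ a b)                         ≡⟨ cong from (cong₂ (mul m′) (strictlyInverseˡ a) (strictlyInverseˡ b)) ⟨
  from (mul m′ (to (from a)) (to (from b))) ≡⟨ cong from (homo (from a) (from b)) ⟨
  from (to (mul m (from a) (from b)))       ≡⟨ strictlyInverseʳ _ ⟩
  mul m (from a) (from b)                   ∎
  where open Inverse I
        open ≡-Reasoning

homomorphic-zer : (h : Elt r k → Elt r k) → Homomorphic m m′ h → h zer ≡ zer
homomorphic-zer {m′ = m′} h homo = idempotent⇒zer m′ (sym (homo zer zer))

-- var x is not a product, and the inverse maps products to products.
↔-var : Surjective-onto-K m′ → (I : Elt r k ↔ Elt r k) → Homomorphic m′ m (Inverse.from I) →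
        ∀ x → ∃ λ u → Inverse.to I (var x) ≡ var u
↔-var {m′ = m′} {m = m} sm′ I homo⁻ x = var-or-product (var⊎mul sm′ (to (var x)))
  where
  open Inverse I
  var-or-product : (∃ λ u → to (var x) ≡ var u) ⊎ (∃₂ λ a b → to (var x) ≡ mul m′ a b) →
                   ∃ λ u → to (var x) ≡ var u
  var-or-product (inj₁ is-var)           = is-var
  var-or-product (inj₂ (a , b , is-mul)) = ⊥-elim (mul≢var m (from a) (from b) (begin
    mul m (from a) (from b) ≡⟨ homo⁻ a b ⟨
    from (mul m′ a b)       ≡⟨ cong from is-mul ⟨
    from (to (var x))       ≡⟨ strictlyInverseʳ (var x) ⟩
    var x                   ∎))
    where open ≡-Reasoning

↔-con : Surjective-onto-K m → (I : Elt r k ↔ Elt r k) → Homomorphic m m′ (Inverse.to I) →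
        ∀ c → ∃ λ d → Inverse.to I (con c) ≡ con d
↔-con {m′ = m′} sm I homo c with sm c
... | x , y , e = con-or-zer (mul-con⊎zer m′ (to (var x)) (to (var y)))
  where
  open Inverse I
  image : to (con c) ≡ mul m′ (to (var x)) (to (var y))
  image = trans (cong to (cong inj (sym e))) (homo (var x) (var y))
  con-or-zer : (∃ λ d → mul m′ (to (var x)) (to (var y)) ≡ con d) ⊎
               mul m′ (to (var x)) (to (var y)) ≡ zer →
               ∃ λ d → to (con c) ≡ con d
  con-or-zer (inj₁ (d , is-con)) = d , trans image is-con
  con-or-zer (inj₂ is-zer)
    with () ← Injection.injective (↔⇒↣ I) (trans (trans image is-zer) (sym (homomorphic-zer to homo)))

↔-restrict : {A B : Set} (e : A → B) → Injective _≡_ _≡_ e → (I : B ↔ B) →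
             (∀ a → ∃ λ a′ → Inverse.to I (e a) ≡ e a′) →
             (∀ a → ∃ λ a′ → Inverse.from I (e a) ≡ e a′) →
             Σ (A ↔ A) λ J → ∀ a → Inverse.to I (e a) ≡ e (Inverse.to J a)
↔-restrict {A} e e-injective I to-e from-e = mk↔ₛ′ to′ from′ to∘from′ from∘to′ , λ a → proj₂ (to-e a)
  where
  open Inverse I
  to′ : A → A
  to′ a = proj₁ (to-e a)
  from′ : A → A
  from′ a = proj₁ (from-e a)
  to∘from′ : ∀ a → to′ (from′ a) ≡ a
  to∘from′ a = e-injective (trans (sym (proj₂ (to-e (from′ a))))
                          (trans (cong to (sym (proj₂ (from-e a)))) (strictlyInverseˡ (e a))))
  from∘to′ : ∀ a → from′ (to′ a) ≡ a
  from∘to′ a = e-injective (trans (sym (proj₂ (from-e (to′ a))))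
                          (trans (cong from (sym (proj₂ (to-e a)))) (strictlyInverseʳ (e a))))

record Relabelling (m m′ : Table r k) : Set where
  field
    π     : Permutation′ r
    σ     : Permutation′ k
    table : ∀ x y → m′ (π ⟨$⟩ʳ x) (π ⟨$⟩ʳ y) ≡ Maybe.map (σ ⟨$⟩ʳ_) (m x y)

relabel : Permutation′ r → Permutation′ k → Elt r k → Elt r k
relabel π σ (var x) = var (π ⟨$⟩ʳ x)
relabel π σ (con c) = con (σ ⟨$⟩ʳ c)
relabel π σ zer     = zer

relabel-inverse : (π : Permutation′ r) (σ : Permutation′ k) (e : Elt r k) →
                  relabel π σ (relabel (flip π) (flip σ) e) ≡ e
relabel-inverse π σ (var x) = cong var (inverseʳ π)
relabel-inverse π σ (con c) = cong con (inverseʳ σ)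
relabel-inverse π σ zer     = refl

relabel-↔ : Permutation′ r → Permutation′ k → Elt r k ↔ Elt r k
relabel-↔ π σ = mk↔ₛ′ (relabel π σ) (relabel (flip π) (flip σ))
                      (relabel-inverse π σ) (relabel-inverse (flip π) (flip σ))

relabel-inj : (π : Permutation′ r) (σ : Permutation′ k) (v : Maybe (Fin k)) →
              relabel π σ (inj v) ≡ inj (Maybe.map (σ ⟨$⟩ʳ_) v)
relabel-inj π σ (just c) = refl
relabel-inj π σ nothing  = refl

relabelling⇒≅ : Relabelling m m′ → N m ≅ N m′
relabelling⇒≅ {m = m} R = ↔⇒≅ (relabel-↔ π σ) homo
  where
  open Relabelling R
  homo : Homomorphic m _ (relabel π σ)
  homo (var x) (var y) = trans (relabel-inj π σ (m x y)) (cong inj (sym (table x y)))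
  homo (var _) (con _) = refl
  homo (var _) zer     = refl
  homo (con _) _       = refl
  homo zer     _       = refl

≅⇒relabelling : Surjective-onto-K m → Surjective-onto-K m′ → N m ≅ N m′ → Relabelling m m′
≅⇒relabelling {r} {k} {m} {m′} sm sm′ iso with ≅⇒↔ iso
... | I , homo = record { π = proj₁ π-restriction ; σ = proj₁ σ-restriction ; table = table }
  where
  open Inverse I
  homo⁻ : Homomorphic m′ m from
  homo⁻ = homomorphic-from I homo
  π-restriction : Σ (Permutation′ r) λ π → ∀ x → to (var x) ≡ var (π ⟨$⟩ʳ x)
  π-restriction = ↔-restrict var var-injective I (↔-var sm′ I homo⁻) (↔-var sm (↔-sym I) homo)
  σ-restriction : Σ (Permutation′ k) λ σ → ∀ c → to (con c) ≡ con (σ ⟨$⟩ʳ c)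
  σ-restriction = ↔-restrict con con-injective I (↔-con sm I homo) (↔-con sm′ (↔-sym I) homo⁻)
  open Σ π-restriction renaming (proj₁ to π; proj₂ to to-var)
  open Σ σ-restriction renaming (proj₁ to σ; proj₂ to to-con)
  to-inj : ∀ v → to (inj v) ≡ inj (Maybe.map (σ ⟨$⟩ʳ_) v)
  to-inj (just c) = to-con c
  to-inj nothing  = homomorphic-zer to homo
  table : ∀ x y → m′ (π ⟨$⟩ʳ x) (π ⟨$⟩ʳ y) ≡ Maybe.map (σ ⟨$⟩ʳ_) (m x y)
  table x y = inj-injective (begin
    mul m′ (var (π ⟨$⟩ʳ x)) (var (π ⟨$⟩ʳ y)) ≡⟨ cong₂ (mul m′) (to-var x) (to-var y) ⟨
    mul m′ (to (var x)) (to (var y))         ≡⟨ homo (var x) (var y) ⟨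
    to (inj (m x y))                         ≡⟨ to-inj (m x y) ⟩
    inj (Maybe.map (σ ⟨$⟩ʳ_) (m x y))        ∎)
    where open ≡-Reasoning

map-fibres : {A B : Set} (σ : A ↔ B) (u : Maybe A) (v : Maybe B) →
             (v ≡ Maybe.map (Inverse.to σ) u) ⇔ (∀ c → u ≡ just c ⇔ v ≡ just (Inverse.to σ c))
map-fibres σ u v = mk⇔ (λ { refl c → mk⇔ (cong (Maybe.map to)) (map-injective to-injective) }) (fibres⇒map u v)
  where
  open Inverse σ
  to-injective : Injective _≡_ _≡_ to
  to-injective = Injection.injective (↔⇒↣ σ)
  fibres⇒map : ∀ u v → (∀ c → u ≡ just c ⇔ v ≡ just (to c)) → v ≡ Maybe.map to u
  fibres⇒map (just c) v F = Equivalence.to (F c) refl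
  fibres⇒map nothing nothing F = refl
  fibres⇒map nothing (just d) F with () ← Equivalence.from (F (from d)) (cong just (sym (strictlyInverseˡ d)))

act-image : (A : Subset² r) (π : Permutation′ r) (x y : Fin r) → act A π (π ⟨$⟩ʳ x , π ⟨$⟩ʳ y) ⇔ A (x , y)
act-image A π x y rewrite inverseˡ π {x} | inverseˡ π {y} = ⇔-id _

≐-on-images : {A B : Subset² r} (π : Permutation′ r) →
              (∀ x y → A (π ⟨$⟩ʳ x , π ⟨$⟩ʳ y) ⇔ B (π ⟨$⟩ʳ x , π ⟨$⟩ʳ y)) → A ≐ B
≐-on-images {A = A} {B} π F (u , v) =
  subst (λ p → A p ⇔ B p) (cong₂ _,_ (inverseʳ π) (inverseʳ π)) (F (π ⟨$⟩ˡ u) (π ⟨$⟩ˡ v))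

actFamily≐⇔fibres : (π : Permutation′ r) (σ : Permutation′ k) →
  (∀ c → actFamily (P m) π c ≐ P m′ (σ ⟨$⟩ʳ c)) ⇔
  (∀ x y c → m x y ≡ just c ⇔ m′ (π ⟨$⟩ʳ x) (π ⟨$⟩ʳ y) ≡ just (σ ⟨$⟩ʳ c))
actFamily≐⇔fibres {m = m} π σ = mk⇔
  (λ E x y c → E c _ ⇔-∘ ⇔-sym (act-image (P m c) π x y))
  (λ F c → ≐-on-images π (λ x y → F x y c ⇔-∘ act-image (P m c) π x y))

Disjoint : (Fin k → Subset² r) → Set
Disjoint A = ∀ {c c′} p → A c p → A c′ p → c ≡ c′

Inhabited : (Fin k → Subset² r) → Set
Inhabited A = ∀ c → ∃ (A c)

P-disjoint : (m : Table r k) → Disjoint (P m)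
P-disjoint m (x , y) e e′ = just-injective (trans (sym e) e′)

P-inhabited : Surjective-onto-K m → Inhabited (P m)
P-inhabited sm c with sm c
... | x , y , e = (x , y) , e

actFamily-disjoint : {A : Fin k → Subset² r} (π : Permutation′ r) → Disjoint A → Disjoint (actFamily A π)
actFamily-disjoint π disjoint (u , v) = disjoint (π ⟨$⟩ˡ u , π ⟨$⟩ˡ v)

actFamily-inhabited : {A : Fin k → Subset² r} (π : Permutation′ r) → Inhabited A → Inhabited (actFamily A π)
actFamily-inhabited {A = A} π inhabited c with inhabited c
... | (x , y) , a = (π ⟨$⟩ʳ x , π ⟨$⟩ʳ y) , Equivalence.from (act-image (A c) π x y) a

permutation⇒sameFamily : {A B : Fin k → Subset² r} (σ : Permutation′ k) →
                         (∀ c → A c ≐ B (σ ⟨$⟩ʳ c)) → SameFamily A B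
permutation⇒sameFamily {A = A} {B} σ E =
  (λ c → σ ⟨$⟩ʳ c , E c) ,
  (λ d → σ ⟨$⟩ˡ d , subst (λ d′ → A (σ ⟨$⟩ˡ d) ≐ B d′) (inverseʳ σ) (E (σ ⟨$⟩ˡ d)))

-- The classes are non-empty and disjoint, so the class matched with a given one is unique.
sameFamily⇒permutation : {A B : Fin k → Subset² r} → Disjoint A → Disjoint B → Inhabited A →
                         SameFamily A B → Σ (Permutation′ k) λ σ → ∀ c → A c ≐ B (σ ⟨$⟩ʳ c)
sameFamily⇒permutation {k} {A = A} {B} A-disjoint B-disjoint inhabited (F₁ , F₂) =
  mk↔ₛ′ σ τ σ∘τ τ∘σ , λ c → proj₂ (F₁ c)
  where
  σ : Fin k → Fin k
  σ c = proj₁ (F₁ c)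
  τ : Fin k → Fin k
  τ d = proj₁ (F₂ d)
  σ∘τ : ∀ d → σ (τ d) ≡ d
  σ∘τ d with inhabited (τ d)
  ... | p , a = B-disjoint p (Equivalence.to (proj₂ (F₁ (τ d)) p) a) (Equivalence.to (proj₂ (F₂ d) p) a)
  τ∘σ : ∀ c → τ (σ c) ≡ c
  τ∘σ c with inhabited c
  ... | p , a = A-disjoint p (Equivalence.from (proj₂ (F₂ (σ c)) p) (Equivalence.to (proj₂ (F₁ c) p) a)) a

relabelling⇒sameOrbit : Relabelling m m′ → SameOrbit (P m) (P m′)
relabelling⇒sameOrbit {m = m} {m′ = m′} R = π , permutation⇒sameFamily σ
  (Equivalence.from (actFamily≐⇔fibres {m = m} {m′ = m′} π σ)
                    (λ x y → Equivalence.to (map-fibres σ _ _) (table x y)))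
  where open Relabelling R

sameOrbit⇒relabelling : Surjective-onto-K m → SameOrbit (P m) (P m′) → Relabelling m m′
sameOrbit⇒relabelling {m = m} {m′ = m′} sm (π , same) with
  sameFamily⇒permutation (actFamily-disjoint π (P-disjoint m)) (P-disjoint m′)
                         (actFamily-inhabited π (P-inhabited sm)) same
... | σ , matched = record
  { π = π
  ; σ = σ
  ; table = λ x y → Equivalence.from (map-fibres σ _ _)
                      (Equivalence.to (actFamily≐⇔fibres {m = m} {m′ = m′} π σ) matched x y)
  }

lemma4p1 : (r k : ℕ) (m m′ : Table r k) →
    Surjective-onto-K m → Surjective-onto-K m′ →
    (N m ≅ N m′) ⇔ SameOrbit (P m) (P m′)
lemma4p1 r k m m′ sm sm′ = mk⇔
  (λ iso → relabelling⇒sameOrbit (≅⇒relabelling sm sm′ iso))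
  (λ orbit → relabelling⇒≅ (sameOrbit⇒relabelling sm orbit))
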